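{- Let $v,w$ be involutions of size $n$ that are slow-climbing. Then their meet $v\wedge w$ in the middle order $\mathcal{P}_n$ is an involution, and it is slow-climbing.
   Context: For $w\in S_n$ (one-line notation), its inversion sequence is $I(w)=(x_1,\ldots,x_n)$ with $x_i=\#\{j<i : w^{ -1}(j)>w^{ -1}(i)\}$. The middle order $\mathcal{P}_n$ is the lattice on $S_n$ with $v\le w$ iff $I(v)\le I(w)$ coordinate-wise; the meet $v\wedge w$ is the permutation whose inversion sequence is the coordinate-wise minimum of $I(v)$ and $I(w)$. For an inversion sequence $x$, an index $i$ is an ascent if $x_i<x_{i+1}$, a small ascent if $x_{i+1}=x_i+1$, and a large ascent otherwise; $x$ is slow-climbing if it has no large ascents. A permutation is slow-climbing if its inversion sequence is. -}

module Defs where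

open import Data.Nat using (ℕ; suc; _<_; _≡ᵇ_)
open import Data.Nat.Base using (_⊓_)
open import Data.Fin using (Fin; toℕ) renaming (_<_ to _<ᶠ_; _<?_ to _<ᶠ?_)
open import Data.Fin.Permutation using (Permutation′; _⟨$⟩ʳ_; _⟨$⟩ˡ_)
open import Data.List using (List; length; filter; allFin)
open import Data.Product using (_×_)
open import Relation.Binary.PropositionalEquality using (_≡_)
open import Relation.Nullary.Decidable using (_×-dec_)

-- Positions/values 1..n of the paper are represented by Fin n (0..n-1);
-- this shift does not affect inversion counts.

invSeq : ∀ {n} → Permutation′ n → Fin n → ℕ
invSeq {n} w i =
  length (filter (λ j → (j <ᶠ? i) ×-dec ((w ⟨$⟩ˡ i) <ᶠ? (w ⟨$⟩ˡ j))) (allFin n))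

minSeq : ∀ {n} → (Fin n → ℕ) → (Fin n → ℕ) → Fin n → ℕ
minSeq x y i = x i ⊓ y i

IsMeet : ∀ {n} → Permutation′ n → Permutation′ n → Permutation′ n → Set
IsMeet u v w = ∀ i → invSeq u i ≡ minSeq (invSeq v) (invSeq w) i

IsInvolution : ∀ {n} → Permutation′ n → Set
IsInvolution w = ∀ i → w ⟨$⟩ʳ (w ⟨$⟩ʳ i) ≡ i

SlowClimbingSeq : ∀ {n} → (Fin n → ℕ) → Set
SlowClimbingSeq {n} x =
  ∀ (i j : Fin n) → toℕ j ≡ suc (toℕ i) → x i < x j → x j ≡ suc (x i)

SlowClimbing : ∀ {n} → Permutation′ n → Set
SlowClimbing w = SlowClimbingSeq (invSeq w)

-- A slow-climbing involution g cuts [0, n) into consecutive intervals and reverses each of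
-- them, and the reversal of such an interval partition has inversion sequence
-- x_i = i − (start of the block of i). The blocks are found from left to right: if g maps
-- [0, s) to itself and t = g s, then x_s = 0, every j in [s, t) is an inversion of t, and the
-- x_j climb by at most one per step, so x_j = j − s on [s, t]; thus every earlier element of
-- [s, j) is an inversion of j and g reverses [s, t]. Intersecting the blocks of v and w gives
-- a partition whose reversal u has x_i(u) = i − max(s_v, s_w) = min(x_i(v), x_i(w)), so u is
-- the meet; it is an involution, and a minimum of slow-climbing sequences is slow-climbing.

module Submission where

open import Defs
open import Data.Nat using (ℕ)
open import Data.Fin.Permutation using (Permutation′)
open import Data.Product using (Σ; _×_)

open import Level using (0ℓ)
open import Data.Nat using (zero; suc; pred; _+_; _∸_; _⊔_; _⊓_; _≤_; _<_; _≤?_; _<?_; _≮_; z≤n; s≤s; s≤s⁻¹)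
open import Data.Nat.Properties
open import Algebra.Properties.CommutativeSemigroup +-commutativeSemigroup using (x∙yz≈yx∙z; xy∙z≈xz∙y)
open import Data.Fin using (Fin; toℕ; fromℕ<) renaming (suc to fsuc; _<_ to _<ᶠ_; _<?_ to _<ᶠ?_)
open import Data.Fin.Properties using (toℕ<n; toℕ-fromℕ<; toℕ-injective)
open import Data.Fin.Permutation using (permutation; _⟨$⟩ʳ_; _⟨$⟩ˡ_; inverseˡ; inverseʳ)
open import Data.List using (List; []; _∷_; length; filter; map; tabulate; allFin)
open import Data.List.Properties using (map-tabulate; filter-≐; filter-none)
open import Data.List.Membership.Propositional using (_∈_)
open import Data.List.Membership.Propositional.Properties using (∈-filter⁺; ∈-filter⁻; ∈-allFin)
open import Data.List.Relation.Binary.Sublist.Propositional as Sublist using (⊆-refl)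
open import Data.List.Relation.Binary.Sublist.Propositional.Properties using (filter⁺; length-mono-≤; to-≋)
open import Data.List.Relation.Binary.Equality.Propositional using (≋⇒≡)
open import Data.List.Relation.Unary.All using (universal)
open import Data.Product using (_,_; proj₁; proj₂)
open import Function using (_∘_; id)
open import Relation.Nullary using (¬_; Dec; yes; no; contradiction)
open import Relation.Nullary.Decidable using (_×-dec_)
open import Relation.Unary using (Pred; Decidable; _⊆_; _≐_)
open import Relation.Binary.PropositionalEquality

count : ∀ {a ℓ} {A : Set a} {P : Pred A ℓ} → Decidable P → List A → ℕ
count P? xs = length (filter P? xs)

count-map : ∀ {a b ℓ} {A : Set a} {B : Set b} {P : Pred B ℓ} (P? : Decidable P) (f : A → B) xs →
            count P? (map f xs) ≡ count (P? ∘ f) xs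
count-map P? f [] = refl
count-map P? f (x ∷ xs) with P? (f x)
... | yes _ = cong suc (count-map P? f xs)
... | no _ = count-map P? f xs

count-tabulate : ∀ {b ℓ n} {B : Set b} {P : Pred B ℓ} (P? : Decidable P) (f : Fin n → B) →
                 count P? (tabulate f) ≡ count (P? ∘ f) (allFin n)
count-tabulate P? f = trans (cong (count P?) (sym (map-tabulate id f))) (count-map P? f (allFin _))

module _ {a ℓ} {A : Set a} {P Q : Pred A ℓ} (P? : Decidable P) (Q? : Decidable Q) (P⊆Q : P ⊆ Q) where

  private
    filter-⊆ : ∀ xs → filter P? xs Sublist.⊆ filter Q? xs
    filter-⊆ xs = filter⁺ P? Q? {as = xs} {bs = xs} (λ { refl → P⊆Q }) ⊆-refl

  count-mono : ∀ xs → count P? xs ≤ count Q? xs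
  count-mono xs = length-mono-≤ (filter-⊆ xs)

  count-≡⇒⊇ : ∀ {xs} → count P? xs ≡ count Q? xs → ∀ {x} → x ∈ xs → Q x → P x
  count-≡⇒⊇ {xs} eq x∈xs Qx = proj₂ (∈-filter⁻ P? {xs = xs} (subst (_ ∈_) filters≡ (∈-filter⁺ Q? x∈xs Qx)))
    where
      filters≡ : filter Q? xs ≡ filter P? xs
      filters≡ = sym (≋⇒≡ (to-≋ eq (filter-⊆ xs)))

Between : ∀ {n} → ℕ → ℕ → Pred (Fin n) 0ℓ
Between s i j = s ≤ toℕ j × toℕ j < i

between? : ∀ {n} s i → Decidable (Between {n} s i)
between? s i j = (s ≤? toℕ j) ×-dec (toℕ j <? i)

Between-suc : ∀ {n} s i → Between {suc n} s (suc i) ∘ fsuc ≐ Between {n} (pred s) i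
Between-suc zero i = (λ (_ , j<) → z≤n , s≤s⁻¹ j<) , (λ (_ , j<) → z≤n , s≤s j<)
Between-suc (suc s) i = (λ (s≤ , j<) → s≤s⁻¹ s≤ , s≤s⁻¹ j<) , (λ (s≤ , j<) → s≤s s≤ , s≤s j<)

count-between : ∀ {n} s i → i ≤ n → count (between? {n} s i) (allFin n) ≡ i ∸ s
count-between-shifted : ∀ {n} s i → i ≤ n → count (between? {suc n} s (suc i)) (tabulate {n = n} fsuc) ≡ i ∸ pred s

count-between {n} s zero _ =
  trans (cong length (filter-none (between? s 0) (universal (λ _ → λ { (_ , ()) }) (allFin n)))) (sym (0∸n≡0 s))
count-between {suc n} zero (suc i) (s≤s i≤n) = cong suc (count-between-shifted zero i i≤n)
count-between {suc n} (suc s) (suc i) (s≤s i≤n) = count-between-shifted (suc s) i i≤n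

count-between-shifted {n} s i i≤n = begin
  count in-range? (tabulate fsuc)         ≡⟨ count-tabulate in-range? fsuc ⟩
  count (in-range? ∘ fsuc) (allFin n)     ≡⟨ cong length (filter-≐ _ (between? (pred s) i) (Between-suc s i) (allFin n)) ⟩
  count (between? (pred s) i) (allFin n)  ≡⟨ count-between (pred s) i i≤n ⟩
  i ∸ pred s                              ∎
  where
    open ≡-Reasoning
    in-range? : Decidable (Between {suc n} s (suc i))
    in-range? = between? s (suc i)

Fin-induction-from : ∀ {n p} (P : Pred (Fin n) p) (c : Fin n) → P c →
  (∀ d d′ → toℕ c ≤ toℕ d → toℕ d′ ≡ suc (toℕ d) → P d → P d′) →
  ∀ d → toℕ c ≤ toℕ d → P d
Fin-induction-from {n} P c Pc step d c≤d = go (toℕ d ∸ toℕ c) d (m+[n∸m]≡n c≤d)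
  where
    go : ∀ k d → toℕ c + k ≡ toℕ d → P d
    go zero d c+0≡d = subst P (toℕ-injective (trans (sym (+-identityʳ (toℕ c))) c+0≡d)) Pc
    go (suc k) d c+1+k≡d = step d′ d (≤-trans (m≤m+n (toℕ c) k) (≤-reflexive (sym d′≡))) d≡ (go k d′ (sym d′≡))
      where
        1+c+k≡d : suc (toℕ c + k) ≡ toℕ d
        1+c+k≡d = trans (sym (+-suc (toℕ c) k)) c+1+k≡d
        c+k<n : toℕ c + k < n
        c+k<n = <-trans (n<1+n _) (subst (_< n) (sym 1+c+k≡d) (toℕ<n d))
        d′ : Fin n
        d′ = fromℕ< c+k<n
        d′≡ : toℕ d′ ≡ toℕ c + k
        d′≡ = toℕ-fromℕ< c+k<n
        d≡ : toℕ d ≡ suc (toℕ d′)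
        d≡ = trans (sym 1+c+k≡d) (cong suc (sym d′≡))

Inversion : ∀ {n} → (Fin n → Fin n) → Fin n → Pred (Fin n) 0ℓ
Inversion g i j = j <ᶠ i × g i <ᶠ g j

inversion? : ∀ {n} (g : Fin n → Fin n) i → Decidable (Inversion g i)
inversion? g i j = (j <ᶠ? i) ×-dec (g i <ᶠ? g j)

-- invSeq w is definitionally inversions (w ⟨$⟩ˡ_).
inversions : ∀ {n} → (Fin n → Fin n) → Fin n → ℕ
inversions {n} g i = count (inversion? g i) (allFin n)

SlowClimbingSeq-step : ∀ {n} {x : Fin n → ℕ} → SlowClimbingSeq x →
                       ∀ i j → toℕ j ≡ suc (toℕ i) → x j ≤ suc (x i)
SlowClimbingSeq-step {x = x} slow i j j≡ with x i <? x j
... | yes ascent = ≤-reflexive (slow i j j≡ ascent)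
... | no ¬ascent = m≤n⇒m≤1+n (≮⇒≥ ¬ascent)

SlowClimbingSeq-resp-≗ : ∀ {n} {x y : Fin n → ℕ} → x ≗ y → SlowClimbingSeq x → SlowClimbingSeq y
SlowClimbingSeq-resp-≗ x≗y slow i j j≡ y-ascent =
  subst₂ (λ yi yj → yj ≡ suc yi) (x≗y i) (x≗y j) (slow i j j≡ (subst₂ _<_ (sym (x≗y i)) (sym (x≗y j)) y-ascent))

SlowClimbingSeq-minSeq : ∀ {n} {x y : Fin n → ℕ} → SlowClimbingSeq x → SlowClimbingSeq y → SlowClimbingSeq (minSeq x y)
SlowClimbingSeq-minSeq slow-x slow-y i j j≡ ascent =
  ≤-antisym (⊓-mono-≤ (SlowClimbingSeq-step slow-x i j j≡) (SlowClimbingSeq-step slow-y i j j≡)) ascent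

⟨$⟩ˡ-involutive : ∀ {n} (w : Permutation′ n) → IsInvolution w → ∀ i → w ⟨$⟩ˡ (w ⟨$⟩ˡ i) ≡ i
⟨$⟩ˡ-involutive w w-involutive i = trans (cong (w ⟨$⟩ˡ_) ˡ≡ʳ) (inverseˡ w)
  where
    ˡ≡ʳ : w ⟨$⟩ˡ i ≡ w ⟨$⟩ʳ i
    ˡ≡ʳ = trans (sym (w-involutive (w ⟨$⟩ˡ i))) (cong (w ⟨$⟩ʳ_) (inverseʳ w))

record IntervalPartition (n : ℕ) : Set where
  field
    start end   : Fin n → ℕ
    start≤      : ∀ i → start i ≤ toℕ i
    ≤end        : ∀ i → toℕ i ≤ end i
    end<n       : ∀ i → end i < n
    block-const : ∀ i j → start i ≤ toℕ j → toℕ j ≤ end i → start j ≡ start i × end j ≡ end i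

module _ {n} (P : IntervalPartition n) where
  open IntervalPartition P

  end<start : ∀ c j → toℕ c < start j → end c < start j
  end<start c j c<sj = ≰⇒> λ sj≤ec → <⇒≱ c<sj (subst (_≤ toℕ c) (start-c≡start-j sj≤ec) (start≤ c))
    where
      sj<n : start j < n
      sj<n = ≤-<-trans (start≤ j) (toℕ<n j)
      m : Fin n
      m = fromℕ< sj<n
      m≡ : toℕ m ≡ start j
      m≡ = toℕ-fromℕ< sj<n
      start-c≡start-j : start j ≤ end c → start c ≡ start j
      start-c≡start-j sj≤ec = trans (sym (proj₁ (block-const c m sc≤m (subst (_≤ end c) (sym m≡) sj≤ec))))
                                    (proj₁ (block-const j m (≤-reflexive (sym m≡)) m≤ej))
        where
          sc≤m : start c ≤ toℕ m
          sc≤m = ≤-trans (start≤ c) (<⇒≤ (subst (toℕ c <_) (sym m≡) c<sj))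
          m≤ej : toℕ m ≤ end j
          m≤ej = subst (_≤ end j) (sym m≡) (≤-trans (start≤ j) (≤end j))

  -- g i = start i + end i − i, without truncated subtraction
  Reverses : (Fin n → Fin n) → Set
  Reverses g = ∀ i → toℕ (g i) + toℕ i ≡ start i + end i

  module _ {g : Fin n → Fin n} (reverses : Reverses g) where

    start≤reversed : ∀ i → start i ≤ toℕ (g i)
    start≤reversed i = +-cancelʳ-≤ (toℕ i) (start i) (toℕ (g i)) (begin
      start i + toℕ i      ≤⟨ +-monoʳ-≤ (start i) (≤end i) ⟩
      start i + end i      ≡⟨ reverses i ⟨
      toℕ (g i) + toℕ i    ∎)
      where open ≤-Reasoning hiding (start)

    reversed≤end : ∀ i → toℕ (g i) ≤ end i
    reversed≤end i = +-cancelʳ-≤ (toℕ i) (toℕ (g i)) (end i) (begin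
      toℕ (g i) + toℕ i    ≡⟨ reverses i ⟩
      start i + end i      ≤⟨ +-monoˡ-≤ (end i) (start≤ i) ⟩
      toℕ i + end i        ≡⟨ +-comm (toℕ i) (end i) ⟩
      end i + toℕ i        ∎)
      where open ≤-Reasoning hiding (start)

    reversed-same-block : ∀ i → start (g i) ≡ start i × end (g i) ≡ end i
    reversed-same-block i = block-const i (g i) (start≤reversed i) (reversed≤end i)

    reverses-involutive : ∀ i → g (g i) ≡ i
    reverses-involutive i = toℕ-injective (+-cancelʳ-≡ (toℕ (g i)) _ _ (begin
      toℕ (g (g i)) + toℕ (g i)  ≡⟨ reverses (g i) ⟩
      start (g i) + end (g i)    ≡⟨ cong₂ _+_ (proj₁ (reversed-same-block i)) (proj₂ (reversed-same-block i)) ⟩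
      start i + end i            ≡⟨ reverses i ⟨
      toℕ (g i) + toℕ i          ≡⟨ +-comm (toℕ (g i)) (toℕ i) ⟩
      toℕ i + toℕ (g i)          ∎))
      where open ≡-Reasoning

    Inversion≐Between : ∀ j → Inversion g j ≐ Between (start j) (toℕ j)
    Inversion≐Between j = inversion⇒between , between⇒inversion
      where
        inversion⇒between : ∀ {c} → Inversion g j c → Between (start j) (toℕ j) c
        inversion⇒between {c} (c<j , gj<gc) = ≮⇒≥ c≮sj , c<j
          where
            c≮sj : toℕ c ≮ start j
            c≮sj c<sj = <⇒≱ gj<gc (≤-trans (reversed≤end c) (≤-trans (<⇒≤ (end<start c j c<sj)) (start≤reversed j)))
        between⇒inversion : ∀ {c} → Between (start j) (toℕ j) c → Inversion g j c
        between⇒inversion {c} (sj≤c , c<j) = c<j , ≰⇒> λ gc≤gj → <-irrefl sums≡ (+-mono-≤-< gc≤gj c<j)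
          where
            same-block : start c ≡ start j × end c ≡ end j
            same-block = block-const j c sj≤c (≤-trans (<⇒≤ c<j) (≤end j))
            sums≡ : toℕ (g c) + toℕ c ≡ toℕ (g j) + toℕ j
            sums≡ = trans (reverses c) (trans (cong₂ _+_ (proj₁ same-block) (proj₂ same-block)) (sym (reverses j)))

    reverses⇒inversions≡ : ∀ j → inversions g j ≡ toℕ j ∸ start j
    reverses⇒inversions≡ j =
      trans (cong length (filter-≐ (inversion? g j) (between? (start j) (toℕ j)) (Inversion≐Between j) (allFin n)))
            (count-between (start j) (toℕ j) (<⇒≤ (toℕ<n j)))

  reverseBlocks : Fin n → Fin n
  reverseBlocks i = fromℕ< reversed<n
    where
      reversed<n : start i + (end i ∸ toℕ i) < n
      reversed<n = ≤-<-trans (≤-trans (+-monoˡ-≤ _ (start≤ i)) (≤-reflexive (m+[n∸m]≡n (≤end i)))) (end<n i)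

  reverseBlocks-reverses : Reverses reverseBlocks
  reverseBlocks-reverses i = begin
    toℕ (reverseBlocks i) + toℕ i           ≡⟨ cong (_+ toℕ i) (toℕ-fromℕ< _) ⟩
    start i + (end i ∸ toℕ i) + toℕ i       ≡⟨ +-assoc (start i) _ _ ⟩
    start i + ((end i ∸ toℕ i) + toℕ i)     ≡⟨ cong (start i +_) (m∸n+n≡m (≤end i)) ⟩
    start i + end i                         ∎
    where open ≡-Reasoning

  reversalPermutation : Permutation′ n
  reversalPermutation = permutation reverseBlocks reverseBlocks reverseBlocks-involutive reverseBlocks-involutive
    where
      reverseBlocks-involutive : ∀ i → reverseBlocks (reverseBlocks i) ≡ i
      reverseBlocks-involutive = reverses-involutive reverseBlocks-reverses

  reversalPermutation-involution : IsInvolution reversalPermutation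
  reversalPermutation-involution = reverses-involutive reverseBlocks-reverses

  invSeq-reversalPermutation : ∀ i → invSeq reversalPermutation i ≡ toℕ i ∸ start i
  invSeq-reversalPermutation = reverses⇒inversions≡ reverseBlocks-reverses

_⊓ᴾ_ : ∀ {n} → IntervalPartition n → IntervalPartition n → IntervalPartition n
P ⊓ᴾ Q = record
  { start       = λ i → P.start i ⊔ Q.start i
  ; end         = λ i → P.end i ⊓ Q.end i
  ; start≤      = λ i → ⊔-lub (P.start≤ i) (Q.start≤ i)
  ; ≤end        = λ i → ⊓-glb (P.≤end i) (Q.≤end i)
  ; end<n       = λ i → ≤-<-trans (m⊓n≤m _ _) (P.end<n i)
  ; block-const = block-const
  }
  where
    module P = IntervalPartition P
    module Q = IntervalPartition Q
    block-const : ∀ i j → P.start i ⊔ Q.start i ≤ toℕ j → toℕ j ≤ P.end i ⊓ Q.end i →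
                  P.start j ⊔ Q.start j ≡ P.start i ⊔ Q.start i × P.end j ⊓ Q.end j ≡ P.end i ⊓ Q.end i
    block-const i j s≤j j≤e = cong₂ _⊔_ (proj₁ in-P) (proj₁ in-Q) , cong₂ _⊓_ (proj₂ in-P) (proj₂ in-Q)
      where
        in-P : P.start j ≡ P.start i × P.end j ≡ P.end i
        in-P = P.block-const i j (≤-trans (m≤m⊔n _ _) s≤j) (≤-trans j≤e (m⊓n≤m _ _))
        in-Q : Q.start j ≡ Q.start i × Q.end j ≡ Q.end i
        in-Q = Q.block-const i j (≤-trans (m≤n⊔m _ _) s≤j) (≤-trans j≤e (m⊓n≤n _ _))

module SlowClimbingInvolution {n} (g : Fin n → Fin n) (g-involutive : ∀ i → g (g i) ≡ i)
                              (slow : SlowClimbingSeq (inversions g)) where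

  X : Fin n → ℕ
  X = inversions g

  X-growth : ∀ c d → toℕ c ≤ toℕ d → X d + toℕ c ≤ X c + toℕ d
  X-growth c = Fin-induction-from (λ d → X d + toℕ c ≤ X c + toℕ d) c ≤-refl step
    where
      step : ∀ d d′ → toℕ c ≤ toℕ d → toℕ d′ ≡ suc (toℕ d) →
             X d + toℕ c ≤ X c + toℕ d → X d′ + toℕ c ≤ X c + toℕ d′
      step d d′ _ d′≡ ih = begin
        X d′ + toℕ c       ≤⟨ +-monoˡ-≤ (toℕ c) (SlowClimbingSeq-step slow d d′ d′≡) ⟩
        suc (X d + toℕ c)  ≤⟨ s≤s ih ⟩
        suc (X c + toℕ d)  ≡⟨ +-suc (X c) (toℕ d) ⟨
        X c + suc (toℕ d)  ≡⟨ cong (X c +_) d′≡ ⟨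
        X c + toℕ d′       ∎
        where open ≤-Reasoning

  ClosedBelow : ℕ → Set
  ClosedBelow s = ∀ j → toℕ j < s → toℕ (g j) < s

  record Block (s e : ℕ) : Set where
    field
      end<n       : e < n
      reversed    : ∀ j → s ≤ toℕ j → toℕ j ≤ e → toℕ (g j) + toℕ j ≡ s + e
      inversions≡ : ∀ j → s ≤ toℕ j → toℕ j ≤ e → X j + s ≡ toℕ j

  block-unique : ∀ {s e s′ e′} → Block s e → Block s′ e′ → ∀ j →
                 s ≤ toℕ j → toℕ j ≤ e → s′ ≤ toℕ j → toℕ j ≤ e′ → s ≡ s′ × e ≡ e′
  block-unique {s} {e} {s′} {e′} B B′ j s≤j j≤e s′≤j j≤e′ = s≡s′ , +-cancelˡ-≡ s e e′ (begin
      s + e              ≡⟨ Block.reversed B j s≤j j≤e ⟨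
      toℕ (g j) + toℕ j  ≡⟨ Block.reversed B′ j s′≤j j≤e′ ⟩
      s′ + e′            ≡⟨ cong (_+ e′) s≡s′ ⟨
      s + e′             ∎)
    where
      open ≡-Reasoning
      s≡s′ : s ≡ s′
      s≡s′ = +-cancelˡ-≡ (X j) s s′ (trans (Block.inversions≡ B j s≤j j≤e) (sym (Block.inversions≡ B′ j s′≤j j≤e′)))

  module FirstBlock (s : ℕ) (s<n : s < n) (closed : ClosedBelow s) where

    a : Fin n
    a = fromℕ< s<n

    a≡s : toℕ a ≡ s
    a≡s = toℕ-fromℕ< s<n

    t : ℕ
    t = toℕ (g a)

    ≥s-preserved : ∀ j → s ≤ toℕ j → s ≤ toℕ (g j)
    ≥s-preserved j s≤j = ≮⇒≥ λ gj<s → <⇒≱ (subst (_< s) (cong toℕ (g-involutive j)) (closed (g j) gj<s)) s≤j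

    s≤t : s ≤ t
    s≤t = ≥s-preserved a (≤-reflexive (sym a≡s))

    X-a≡0 : X a ≡ 0
    X-a≡0 = cong length (filter-none (inversion? g a) (universal not-inversion (allFin n)))
      where
        not-inversion : ∀ j → ¬ Inversion g a j
        not-inversion j (j<a , ga<gj) = <-irrefl refl (<-trans ga<gj (<-≤-trans (closed j (subst (toℕ j <_) a≡s j<a)) s≤t))

    t≤X-ga+s : t ≤ X (g a) + s
    t≤X-ga+s = begin
      t                        ≡⟨ m∸n+n≡m s≤t ⟨
      (t ∸ s) + s              ≡⟨ cong (_+ s) (count-between s t (<⇒≤ (toℕ<n (g a)))) ⟨
      count (between? s t) (allFin n) + s ≤⟨ +-monoˡ-≤ s (count-mono (between? s t) (inversion? g (g a)) between⇒inversion (allFin n)) ⟩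
      X (g a) + s              ∎
      where
        open ≤-Reasoning hiding (start)
        between⇒inversion : Between s t ⊆ Inversion g (g a)
        between⇒inversion {j} (s≤j , j<t) = j<t , subst (λ x → toℕ x < toℕ (g j)) (sym (g-involutive a)) a<gj
          where
            a<gj : toℕ a < toℕ (g j)
            a<gj = subst (_< toℕ (g j)) (sym a≡s) (≤∧≢⇒< (≥s-preserved j s≤j) λ s≡gj →
                     <-irrefl (cong toℕ (sym (trans (cong g (toℕ-injective (trans a≡s s≡gj))) (g-involutive j)))) j<t)

    block-inversions : ∀ j → s ≤ toℕ j → toℕ j ≤ t → X j + s ≡ toℕ j
    block-inversions j s≤j j≤t = ≤-antisym upper lower
      where
        upper : X j + s ≤ toℕ j
        upper = begin
          X j + s        ≡⟨ cong (X j +_) a≡s ⟨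
          X j + toℕ a    ≤⟨ X-growth a j (subst (_≤ toℕ j) (sym a≡s) s≤j) ⟩
          X a + toℕ j    ≡⟨ cong (_+ toℕ j) X-a≡0 ⟩
          toℕ j          ∎
          where open ≤-Reasoning hiding (start)
        lower : toℕ j ≤ X j + s
        lower = +-cancelʳ-≤ t (toℕ j) (X j + s) (begin
          toℕ j + t                ≤⟨ +-monoʳ-≤ (toℕ j) t≤X-ga+s ⟩
          toℕ j + (X (g a) + s)    ≡⟨ x∙yz≈yx∙z (toℕ j) (X (g a)) s ⟩
          (X (g a) + toℕ j) + s    ≤⟨ +-monoˡ-≤ s (X-growth j (g a) j≤t) ⟩
          (X j + t) + s            ≡⟨ xy∙z≈xz∙y (X j) t s ⟩
          (X j + s) + t            ∎)
          where open ≤-Reasoning hiding (start)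

    g-decreasing : ∀ c j → s ≤ toℕ c → toℕ c < toℕ j → toℕ j ≤ t → toℕ (g j) < toℕ (g c)
    g-decreasing c j s≤c c<j j≤t =
      proj₂ (count-≡⇒⊇ (inversion? g j) (between? s (toℕ j)) inversion⇒between counts≡ (∈-allFin c) (s≤c , c<j))
      where
        s≤j : s ≤ toℕ j
        s≤j = ≤-trans s≤c (<⇒≤ c<j)
        inversion⇒between : Inversion g j ⊆ Between s (toℕ j)
        inversion⇒between {c′} (c′<j , gj<gc′) = ≮⇒≥ c′≮s , c′<j
          where
            c′≮s : toℕ c′ ≮ s
            c′≮s c′<s = <⇒≱ (<-trans gj<gc′ (closed c′ c′<s)) (≥s-preserved j s≤j)
        counts≡ : X j ≡ count (between? s (toℕ j)) (allFin n)
        counts≡ = begin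
          X j              ≡⟨ m+n∸n≡m (X j) s ⟨
          X j + s ∸ s      ≡⟨ cong (_∸ s) (block-inversions j s≤j j≤t) ⟩
          toℕ j ∸ s        ≡⟨ count-between s (toℕ j) (<⇒≤ (toℕ<n j)) ⟨
          count (between? s (toℕ j)) (allFin n) ∎
          where open ≡-Reasoning

    reversed-sum-antitone : ∀ c d → s ≤ toℕ c → toℕ c ≤ toℕ d → toℕ d ≤ t → toℕ (g d) + toℕ d ≤ toℕ (g c) + toℕ c
    reversed-sum-antitone c d s≤c c≤d = Fin-induction-from Below c (λ _ → ≤-refl) step d c≤d
      where
        Below : Fin n → Set
        Below d = toℕ d ≤ t → toℕ (g d) + toℕ d ≤ toℕ (g c) + toℕ c
        step : ∀ d d′ → toℕ c ≤ toℕ d → toℕ d′ ≡ suc (toℕ d) → Below d → Below d′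
        step d d′ c≤d d′≡ ih d′≤t = begin
          toℕ (g d′) + toℕ d′       ≡⟨ cong (toℕ (g d′) +_) d′≡ ⟩
          toℕ (g d′) + suc (toℕ d)  ≡⟨ +-suc (toℕ (g d′)) (toℕ d) ⟩
          suc (toℕ (g d′)) + toℕ d  ≤⟨ +-monoˡ-≤ (toℕ d) (g-decreasing d d′ (≤-trans s≤c c≤d) d<d′ d′≤t) ⟩
          toℕ (g d) + toℕ d         ≤⟨ ih (≤-trans (<⇒≤ d<d′) d′≤t) ⟩
          toℕ (g c) + toℕ c         ∎
          where
            open ≤-Reasoning hiding (start)
            d<d′ : toℕ d < toℕ d′
            d<d′ = ≤-reflexive (sym d′≡)

    block-reversed : ∀ j → s ≤ toℕ j → toℕ j ≤ t → toℕ (g j) + toℕ j ≡ s + t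
    block-reversed j s≤j j≤t = ≤-antisym
      (begin
        toℕ (g j) + toℕ j  ≤⟨ reversed-sum-antitone a j (≤-reflexive (sym a≡s)) (subst (_≤ toℕ j) (sym a≡s) s≤j) j≤t ⟩
        t + toℕ a          ≡⟨ cong (t +_) a≡s ⟩
        t + s              ≡⟨ +-comm t s ⟩
        s + t              ∎)
      (begin
        s + t                  ≡⟨ cong (_+ t) (trans (sym a≡s) (cong toℕ (sym (g-involutive a)))) ⟩
        toℕ (g (g a)) + t      ≤⟨ reversed-sum-antitone j (g a) s≤j j≤t ≤-refl ⟩
        toℕ (g j) + toℕ j      ∎)
      where open ≤-Reasoning hiding (start)

    block : Block s t
    block = record
      { end<n       = toℕ<n (g a)
      ; reversed    = block-reversed
      ; inversions≡ = block-inversions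
      }

    closed-after : ClosedBelow (suc t)
    closed-after j j≤t with toℕ j <? s
    ... | yes j<s = s≤s (≤-trans (<⇒≤ (closed j j<s)) s≤t)
    ... | no j≮s = s≤s (+-cancelʳ-≤ s (toℕ (g j)) t (begin
      toℕ (g j) + s      ≤⟨ +-monoʳ-≤ (toℕ (g j)) (≮⇒≥ j≮s) ⟩
      toℕ (g j) + toℕ j  ≡⟨ block-reversed j (≮⇒≥ j≮s) (s≤s⁻¹ j≤t) ⟩
      s + t              ≡⟨ +-comm s t ⟩
      t + s              ∎))
      where open ≤-Reasoning hiding (start)

  record BlockAround (i : Fin n) : Set where
    field
      start end : ℕ
      start≤i   : start ≤ toℕ i
      i≤end     : toℕ i ≤ end
      block     : Block start end

  -- k bounds the number of blocks still to be split off before reaching i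
  blockAround : ∀ i k s → ClosedBelow s → s ≤ toℕ i → toℕ i < s + k → BlockAround i
  blockAround i zero s _ s≤i i<s+0 = contradiction (subst (toℕ i <_) (+-identityʳ s) i<s+0) (≤⇒≯ s≤i)
  blockAround i (suc k) s closed s≤i i<s+1+k = extend (toℕ i ≤? F.t)
    where
      module F = FirstBlock s (≤-<-trans s≤i (toℕ<n i)) closed
      extend : Dec (toℕ i ≤ F.t) → BlockAround i
      extend (yes i≤t) = record { start = s ; end = F.t ; start≤i = s≤i ; i≤end = i≤t ; block = F.block }
      extend (no i≰t) = blockAround i k (suc F.t) F.closed-after (≰⇒> i≰t) (begin-strict
        toℕ i        <⟨ i<s+1+k ⟩
        s + suc k    ≡⟨ +-suc s k ⟩
        suc s + k    ≤⟨ +-monoˡ-≤ k (s≤s F.s≤t) ⟩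
        suc F.t + k  ∎)
        where open ≤-Reasoning hiding (start)

  around : ∀ i → BlockAround i
  around i = blockAround i n 0 (λ _ ()) z≤n (toℕ<n i)

  module Around (i : Fin n) = BlockAround (around i)

  blocks : IntervalPartition n
  blocks = record
    { start       = Around.start
    ; end         = Around.end
    ; start≤      = Around.start≤i
    ; ≤end        = Around.i≤end
    ; end<n       = λ i → Block.end<n (Around.block i)
    ; block-const = λ i j s≤j j≤e →
        block-unique (Around.block j) (Around.block i) j (Around.start≤i j) (Around.i≤end j) s≤j j≤e
    }

  blocks-reverses : Reverses blocks g
  blocks-reverses i = Block.reversed (Around.block i) i (Around.start≤i i) (Around.i≤end i)

module _ {n} (w : Permutation′ n) (w-involutive : IsInvolution w) (w-slow : SlowClimbing w) where

  private
    module W = SlowClimbingInvolution (w ⟨$⟩ˡ_) (⟨$⟩ˡ-involutive w w-involutive) w-slow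

  blocksOf : IntervalPartition n
  blocksOf = W.blocks

  invSeq-blocksOf : ∀ i → invSeq w i ≡ toℕ i ∸ IntervalPartition.start blocksOf i
  invSeq-blocksOf = reverses⇒inversions≡ blocksOf W.blocks-reverses

corollary5p4 : (n : ℕ) (v w : Permutation′ n) →
    IsInvolution v → SlowClimbing v →
    IsInvolution w → SlowClimbing w →
    Σ (Permutation′ n) (λ u → IsMeet u v w × IsInvolution u × SlowClimbing u)
corollary5p4 n v w v-involutive v-slow w-involutive w-slow =
  u , u-meet , reversalPermutation-involution R , SlowClimbingSeq-resp-≗ (sym ∘ u-meet) (SlowClimbingSeq-minSeq v-slow w-slow)
  where
    open IntervalPartition using (start)
    Pv Pw R : IntervalPartition n
    Pv = blocksOf v v-involutive v-slow
    Pw = blocksOf w w-involutive w-slow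
    R = Pv ⊓ᴾ Pw
    u : Permutation′ n
    u = reversalPermutation R
    u-meet : IsMeet u v w
    u-meet i = begin
      invSeq u i                                   ≡⟨ invSeq-reversalPermutation R i ⟩
      toℕ i ∸ (start Pv i ⊔ start Pw i)            ≡⟨ ∸-distribˡ-⊔-⊓ (toℕ i) (start Pv i) (start Pw i) ⟩
      (toℕ i ∸ start Pv i) ⊓ (toℕ i ∸ start Pw i)  ≡⟨ cong₂ _⊓_ (invSeq-blocksOf v v-involutive v-slow i)
                                                                (invSeq-blocksOf w w-involutive w-slow i) ⟨
      minSeq (invSeq v) (invSeq w) i               ∎
      where open ≡-Reasoning
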